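{- For each prime $p$ and each positive integer $\alpha$, the zero-divisor graph $\Gamma(R)$ of the ring $R = \mathbb{Z}_{p^{\alpha}}[x]/(x^2, px)$ is a connected threshold graph.
   Context: For a finite commutative ring $R$ with unity, the zero-divisor graph $\Gamma(R)$ is the simple graph whose vertex set is all of $R$, two distinct vertices $x,y\in R$ being adjacent if and only if $xy=0$ in $R$. A graph is a threshold graph if it can be obtained from the one-vertex graph $K_1$ by repeatedly (any number of times, in any order) adding either an isolated vertex or a dominating vertex (a new vertex adjacent to all existing vertices). -}

module Defs where

open import Data.Nat using (ℕ; zero; suc; _+_; _*_; _^_; NonZero)
open import Data.Nat.Properties using (m^n≢0)
open import Data.Nat.DivMod using (_mod_)
open import Data.Fin using (Fin; zero; suc; toℕ)
open import Data.Product using (_×_; _,_; Σ; ∃)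
open import Relation.Nullary using (¬_)
open import Relation.Binary.PropositionalEquality using (_≡_; _≢_)
open import Relation.Binary.Construct.Closure.ReflexiveTransitive using (Star)
open import Function.Bundles using (_⤖_; Bijection)

record Graph : Set₁ where
  field
    Vertex : Set
    Adj    : Vertex → Vertex → Set
open Graph public

IsConnected : Graph → Set
IsConnected G = ∀ (x y : Vertex G) → Star (Adj G) x y

-- Threshold graphs on vertex set Fin n, built from K₁ by repeatedly
-- adding a new vertex (always placed at index zero, the old vertices
-- being the successors) that is either isolated or dominating.
data IsThresholdFin : (n : ℕ) → (Fin n → Fin n → Set) → Set₁ where
  k1       : (E : Fin 1 → Fin 1 → Set) →
             (∀ i j → ¬ E i j) →
             IsThresholdFin 1 E
  addIsol  : ∀ {n} (E : Fin (suc n) → Fin (suc n) → Set) →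
             IsThresholdFin n (λ i j → E (suc i) (suc j)) →
             (∀ j → ¬ E zero j) → (∀ j → ¬ E j zero) →
             IsThresholdFin (suc n) E
  addDom   : ∀ {n} (E : Fin (suc n) → Fin (suc n) → Set) →
             IsThresholdFin n (λ i j → E (suc i) (suc j)) →
             (∀ j → E zero (suc j)) → (∀ j → E (suc j) zero) →
             ¬ E zero zero →
             IsThresholdFin (suc n) E

IsThreshold : Graph → Set₁
IsThreshold G =
  Σ ℕ λ n → Σ (Fin n ⤖ Vertex G) λ f →
    IsThresholdFin n (λ i j → Adj G (Bijection.to f i) (Bijection.to f j))

-- The ring R = ℤ_{p^α}[x]/(x², px).
-- Every element is uniquely a + b·x with a ∈ ℤ_{p^α} and b ∈ ℤ_p
-- (the x-coefficient lives in ℤ_{p^α}/(p) = ℤ_p because px = 0).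

module _ (p α : ℕ) (nz : NonZero p) where
  private instance
    nzp  : NonZero p
    nzp  = nz
    nzpa : NonZero (p ^ α)
    nzpa = m^n≢0 p α

  R : Set
  R = Fin (p ^ α) × Fin p

  0R : R
  0R = (0 mod (p ^ α)) , (0 mod p)

  1R : R
  1R = (1 mod (p ^ α)) , (0 mod p)

  _+R_ : R → R → R
  (a , b) +R (c , d) = ((toℕ a + toℕ c) mod (p ^ α)) , ((toℕ b + toℕ d) mod p)

  -- (a + b x)(c + d x) = ac + (ad + bc) x   (using x² = 0)
  _*R_ : R → R → R
  (a , b) *R (c , d) = ((toℕ a * toℕ c) mod (p ^ α)) ,
                       ((toℕ a * toℕ d + toℕ b * toℕ c) mod p)

  Γ : Graph
  Γ = record { Vertex = R ; Adj = λ x y → (x ≢ y) × (x *R y ≡ 0R) }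

{-# OPTIONS --safe #-}
-- Write the elements of R as a + bx with a ∈ ℤ/p^α and b ∈ ℤ/p, so that (a + bx)(c + dx) = 0
-- iff p^α ∣ ac and p ∣ ad + bc. Weight a + bx by 2ν(a) when a ≠ 0 (ν the p-adic valuation),
-- by 2α − 1 when a = 0 ≠ b, and by 2α for 0. Two distinct elements are then adjacent exactly
-- when their weights add up to at least 2α, and every finite graph with such a weighting is a
-- threshold graph: repeatedly remove the lightest vertex (isolated) or the heaviest (dominating).
-- The vertex 0 has the maximal weight 2α, so it dominates Γ(R), which is therefore connected.
module Submission where

open import Defs
open import Data.Nat using (ℕ; zero; suc; _+_; _*_; _^_; _∸_; _%_; _≤_; _<_; _≤?_; NonZero; z≤n; z<s; s≤s⁻¹; >-nonZero⁻¹)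
open import Data.Nat.Properties
  using ( ≤-refl; ≤-trans; ≤-reflexive; ≤∧≢⇒<; <⇒≱; m≤m+n; m≤n+m; m<m+n; m≤n⇒m≤1+n; m≤n⇒m<n∨m≡n
        ; n≢0⇒n>0; +-comm; +-suc; +-identityʳ; +-mono-≤; +-monoˡ-≤; +-monoʳ-≤; +-cancelˡ-<
        ; *-comm; *-suc; *-identityʳ; *-distribˡ-+; *-monoʳ-≤; *-monoʳ-<; *-cancelˡ-≤; *-cancelˡ-<
        ; m∸n+n≡m; ^-distribˡ-+-*; m^n≢0 )
open import Data.Nat.Divisibility
  using ( _∣_; divides; _∣?_; 1∣_; _∣0; ∣-trans; ∣⇒≤; m∣m*n; ∣m⇒∣m*n; ∣n⇒∣m*n; ∣m∣n⇒∣m+n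
        ; *-pres-∣; *-monoʳ-∣; *-cancelˡ-∣; m%n≡0⇒n∣m; n∣m⇒m%n≡0 )
open import Data.Nat.DivMod using (_mod_; m<n⇒m%n≡m)
open import Data.Nat.Primality using (Prime; euclidsLemma; prime⇒nonZero)
open import Data.Nat.Tactic.RingSolver using (solve-∀)
open import Data.Fin using (Fin; zero; suc; toℕ; punchIn)
open import Data.Fin.Properties using (¬Fin0; punchIn-injective; punchInᵢ≢i; toℕ-fromℕ<; toℕ-injective; toℕ<n; *↔×; _≟_)
open import Data.Fin.Permutation using (Permutation′; _⟨$⟩ʳ_; insert)
import Data.Fin.Permutation as Permutation
open import Data.List using (allFin)
open import Data.List.Extrema.Nat using (argmin; argmax; f[argmin]≤f[xs]; f[xs]≤f[argmax])
open import Data.List.Membership.Propositional.Properties using (∈-allFin)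
import Data.List.Relation.Unary.All as All
open import Data.Product using (_×_; _,_; ∃; ∃₂; proj₁; proj₂)
open import Data.Product.Properties using (≡-dec; ×-≡,≡→≡; ×-≡,≡←≡)
open import Data.Product.Function.NonDependent.Propositional using (_×-⇔_)
open import Data.Sum using (_⊎_; inj₁; inj₂)
open import Data.Empty using (⊥-elim)
open import Function using (_∘_)
open import Function.Bundles using (_⤖_; Bijection; _⇔_; mk⇔; Equivalence)
open import Function.Definitions using (Injective)
open import Function.Construct.Composition using (_⤖-∘_; _⇔-∘_)
open import Function.Construct.Symmetry using (⇔-sym)
open import Function.Related.Propositional using (module EquationalReasoning; equivalence)
open import Function.Properties.Inverse using (↔⇒⤖)
open import Relation.Nullary using (¬_; yes; no; contradiction)
open import Relation.Binary.Definitions using (DecidableEquality)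
open import Relation.Binary.PropositionalEquality using (_≡_; _≢_; refl; sym; trans; cong; cong₂; subst; module ≡-Reasoning)
open import Relation.Binary.Construct.Closure.ReflexiveTransitive using (Star; ε; _◅_; _◅◅_)

Isolated : {V : Set} → (V → V → Set) → V → Set
Isolated E x = ∀ y → ¬ E x y × ¬ E y x

Dominating : {V : Set} → (V → V → Set) → V → Set
Dominating E x = ∀ y → x ≢ y → E x y × E y x

record IsThresholdWeighting {V : Set} (E : V → V → Set) (w : V → ℕ) (t : ℕ) : Set where
  field
    irreflexive    : ∀ x → ¬ E x x
    heavy⇒adjacent : ∀ {x y} → x ≢ y → t ≤ w x + w y → E x y
    adjacent⇒heavy : ∀ {x y} → E x y → t ≤ w x + w y

  heavy⇒adjacent₂ : ∀ {x y} → x ≢ y → t ≤ w x + w y → E x y × E y x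
  heavy⇒adjacent₂ {x} {y} x≢y t≤ =
    heavy⇒adjacent x≢y t≤ , heavy⇒adjacent (x≢y ∘ sym) (subst (t ≤_) (+-comm (w x) (w y)) t≤)

  light⇒nonadjacent₂ : ∀ {x y} → ¬ t ≤ w x + w y → ¬ E x y × ¬ E y x
  light⇒nonadjacent₂ {x} {y} t≰ =
    t≰ ∘ adjacent⇒heavy , t≰ ∘ subst (t ≤_) (+-comm (w y) (w x)) ∘ adjacent⇒heavy

  heavy⇒dominating : ∀ {x} → t ≤ w x → Dominating E x
  heavy⇒dominating {x} t≤ y x≢y = heavy⇒adjacent₂ x≢y (≤-trans t≤ (m≤m+n (w x) (w y)))

open IsThresholdWeighting

restrict : ∀ {U V : Set} {E : V → V → Set} {w t} (f : U → V) → Injective _≡_ _≡_ f →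
           IsThresholdWeighting E w t → IsThresholdWeighting (λ x y → E (f x) (f y)) (w ∘ f) t
restrict f f-inj tw = record
  { irreflexive    = irreflexive tw ∘ f
  ; heavy⇒adjacent = λ x≢y → heavy⇒adjacent tw (x≢y ∘ f-inj)
  ; adjacent⇒heavy = adjacent⇒heavy tw
  }

module _ {n} {E : Fin (suc n) → Fin (suc n) → Set} {w t} (tw : IsThresholdWeighting E w t) where

  private
    m M : Fin (suc n)
    m = argmin w zero (allFin _)
    M = argmax w zero (allFin _)

    minimal : ∀ y → w m ≤ w y
    minimal y = All.lookup (f[argmin]≤f[xs] {f = w} zero (allFin _)) (∈-allFin y)

    maximal : ∀ y → w y ≤ w M
    maximal y = All.lookup (f[xs]≤f[argmax] {f = w} zero (allFin _)) (∈-allFin y)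

  -- If the lightest vertex m and the heaviest vertex M are not adjacent, m is adjacent to
  -- nothing; otherwise M is adjacent to everything.
  isolated⊎dominating : ∃ λ x → Isolated E x ⊎ Dominating E x
  isolated⊎dominating with t ≤? w m + w M
  ... | yes t≤ = M , inj₂ λ y M≢y → heavy⇒adjacent₂ tw M≢y
                   (≤-trans t≤ (≤-trans (+-monoˡ-≤ (w M) (minimal y)) (≤-reflexive (+-comm (w y) (w M)))))
  ... | no t≰ = m , inj₁ λ y → light⇒nonadjacent₂ tw (t≰ ∘ λ t≤ → ≤-trans t≤ (+-monoʳ-≤ (w m) (maximal y)))

HasThresholdOrder : ∀ n → (Fin n → Fin n → Set) → Set₁
HasThresholdOrder n E = ∃ λ (π : Permutation′ n) → IsThresholdFin n (λ i j → E (π ⟨$⟩ʳ i) (π ⟨$⟩ʳ j))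

module _ {n} {E : Fin (suc n) → Fin (suc n) → Set} (q : Fin (suc n)) where

  insert-isolated : Isolated E q → HasThresholdOrder n (λ i j → E (punchIn q i) (punchIn q j)) →
                    HasThresholdOrder (suc n) E
  insert-isolated isolated (π , thr) =
    insert zero q π , addIsol _ thr (proj₁ ∘ isolated ∘ (insert zero q π ⟨$⟩ʳ_))
                                    (proj₂ ∘ isolated ∘ (insert zero q π ⟨$⟩ʳ_))

  insert-dominating : ¬ E q q → Dominating E q →
                      HasThresholdOrder n (λ i j → E (punchIn q i) (punchIn q j)) →
                      HasThresholdOrder (suc n) E
  insert-dominating ¬Eqq dominating (π , thr) =
    insert zero q π , addDom _ thr (proj₁ ∘ dominating′) (proj₂ ∘ dominating′) ¬Eqq
    where
    dominating′ : ∀ j → E q (punchIn q (π ⟨$⟩ʳ j)) × E (punchIn q (π ⟨$⟩ʳ j)) q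
    dominating′ j = dominating _ (punchInᵢ≢i q (π ⟨$⟩ʳ j) ∘ sym)

thresholdWeighting⇒HasThresholdOrder : ∀ n {E : Fin (suc n) → Fin (suc n) → Set} {w t} →
  IsThresholdWeighting E w t → HasThresholdOrder (suc n) E
thresholdWeighting⇒HasThresholdOrder zero    tw =
  Permutation.id , k1 _ λ { zero zero → irreflexive tw zero }
thresholdWeighting⇒HasThresholdOrder (suc n) {E} tw = extend (isolated⊎dominating tw)
  where
  rest : ∀ q → HasThresholdOrder (suc n) (λ i j → E (punchIn q i) (punchIn q j))
  rest q = thresholdWeighting⇒HasThresholdOrder n (restrict (punchIn q) (punchIn-injective q _ _) tw)

  extend : (∃ λ q → Isolated E q ⊎ Dominating E q) → HasThresholdOrder (suc (suc n)) E
  extend (q , inj₁ isolated)   = insert-isolated q isolated (rest q)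
  extend (q , inj₂ dominating) = insert-dominating q (irreflexive tw q) dominating (rest q)

-- The vertex asked for rules out the empty graph, which IsThresholdFin does not cover.
thresholdWeighting⇒IsThreshold : (G : Graph) {w : Vertex G → ℕ} {t : ℕ} →
  IsThresholdWeighting (Adj G) w t → ∀ {N} → Fin N ⤖ Vertex G → Vertex G → IsThreshold G
thresholdWeighting⇒IsThreshold G tw {zero}  f x = ⊥-elim (¬Fin0 (proj₁ (Bijection.surjective f x)))
thresholdWeighting⇒IsThreshold G tw {suc n} f _ =
  lift (thresholdWeighting⇒HasThresholdOrder n (restrict (Bijection.to f) (Bijection.injective f) tw))
  where
  lift : HasThresholdOrder (suc n) (λ i j → Adj G (Bijection.to f i) (Bijection.to f j)) → IsThreshold G
  lift (π , thr) = suc n , f ⤖-∘ ↔⇒⤖ π , thr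

dominating⇒connected : (G : Graph) → DecidableEquality (Vertex G) →
                       ∀ {z} → Dominating (Adj G) z → IsConnected G
dominating⇒connected G _≟_ {z} dominating x y = toHub x ◅◅ fromHub y
  where
  toHub : ∀ x → Star (Adj G) x z
  toHub x with x ≟ z
  ... | yes refl = ε
  ... | no x≢z = proj₂ (dominating x (x≢z ∘ sym)) ◅ ε

  fromHub : ∀ y → Star (Adj G) z y
  fromHub y with z ≟ y
  ... | yes refl = ε
  ... | no z≢y = proj₁ (dominating y z≢y) ◅ ε

private
  ≤⇔2*≤2*+2* : ∀ {m n o} → m ≤ n + o ⇔ 2 * m ≤ 2 * n + 2 * o
  ≤⇔2*≤2*+2* {m} {n} {o} = mk⇔
    (λ m≤ → subst (2 * m ≤_) (*-distribˡ-+ 2 n o) (*-monoʳ-≤ 2 m≤))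
    (λ 2m≤ → *-cancelˡ-≤ 2 (subst (2 * m ≤_) (sym (*-distribˡ-+ 2 n o)) 2m≤))

  factorˡ : ∀ q p c → q * p * c ≡ p * (q * c)
  factorˡ = solve-∀

  factorʳ : ∀ a q p → a * (q * p) ≡ p * (a * q)
  factorʳ = solve-∀

module Valuation (p : ℕ) where

  -- The exponent of the largest power of p dividing a, capped at k (so that ν k 0 = k).
  ν : ℕ → ℕ → ℕ
  ν zero    a = zero
  ν (suc k) a with p ^ suc k ∣? a
  ... | yes _ = suc k
  ... | no  _ = ν k a

  ν≤ : ∀ k a → ν k a ≤ k
  ν≤ zero    a = z≤n
  ν≤ (suc k) a with p ^ suc k ∣? a
  ... | yes _ = ≤-refl
  ... | no  _ = m≤n⇒m≤1+n (ν≤ k a)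

  p^ν∣ : ∀ k a → p ^ ν k a ∣ a
  p^ν∣ zero    a = 1∣ a
  p^ν∣ (suc k) a with p ^ suc k ∣? a
  ... | yes p^k+1∣a = p^k+1∣a
  ... | no  _       = p^ν∣ k a

  ∣⇒≤ν : ∀ {k a i} → i ≤ k → p ^ i ∣ a → i ≤ ν k a
  ∣⇒≤ν {zero}  i≤0    _    = i≤0
  ∣⇒≤ν {suc k} {a} {i} i≤1+k p^i∣a with p ^ suc k ∣? a | m≤n⇒m<n∨m≡n i≤1+k
  ... | yes _         | _           = i≤1+k
  ... | no  _         | inj₁ i<1+k  = ∣⇒≤ν (s≤s⁻¹ i<1+k) p^i∣a
  ... | no  p^1+k∤a   | inj₂ refl   = contradiction p^i∣a p^1+k∤a

  ν<cap : ∀ {k a} .{{_ : NonZero a}} → a < p ^ k → ν k a < k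
  ν<cap {k} {a} a<p^k = ≤∧≢⇒< (ν≤ k a) λ ν≡k →
    <⇒≱ a<p^k (∣⇒≤ (subst (λ i → p ^ i ∣ a) ν≡k (p^ν∣ k a)))

  p^i∣p^j : ∀ {i j} → i ≤ j → p ^ i ∣ p ^ j
  p^i∣p^j {i} {j} i≤j = divides (p ^ (j ∸ i)) (begin
    p ^ j               ≡⟨ cong (p ^_) (m∸n+n≡m i≤j) ⟨
    p ^ (j ∸ i + i)     ≡⟨ ^-distribˡ-+-* p (j ∸ i) i ⟩
    p ^ (j ∸ i) * p ^ i ∎)
    where open ≡-Reasoning

  p∣⇔0<ν : ∀ {k a} → 0 < k → p ∣ a ⇔ 0 < ν k a
  p∣⇔0<ν {k} {a} 0<k = mk⇔
    (λ p∣a → ∣⇒≤ν 0<k (subst (_∣ a) (sym (*-identityʳ p)) p∣a))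
    (λ 0<ν → ∣-trans (subst (_∣ p ^ ν k a) (*-identityʳ p) (p^i∣p^j 0<ν)) (p^ν∣ k a))

  module _ (prime : Prime p) where
    private instance
      nonZero-p : NonZero p
      nonZero-p = prime⇒nonZero prime

    p^k∣*-split : ∀ k a c → p ^ k ∣ a * c → ∃₂ λ i j → i + j ≡ k × p ^ i ∣ a × p ^ j ∣ c
    p^k∣*-split zero a c _ = 0 , 0 , refl , 1∣ a , 1∣ c
    p^k∣*-split (suc k) a c p^1+k∣ac with euclidsLemma a c prime (∣-trans (m∣m*n (p ^ k)) p^1+k∣ac)
    ... | inj₁ (divides q refl)
        with i , j , refl , p^i∣q , p^j∣c ← p^k∣*-split k q c (*-cancelˡ-∣ p (subst (p ^ suc k ∣_) (factorˡ q p c) p^1+k∣ac))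
        = suc i , j , refl , subst (p * p ^ i ∣_) (*-comm p q) (*-monoʳ-∣ p p^i∣q) , p^j∣c
    ... | inj₂ (divides q refl)
        with i , j , refl , p^i∣a , p^j∣q ← p^k∣*-split k a q (*-cancelˡ-∣ p (subst (p ^ suc k ∣_) (factorʳ a q p) p^1+k∣ac))
        = i , suc j , +-suc i j , p^i∣a , subst (p * p ^ j ∣_) (*-comm p q) (*-monoʳ-∣ p p^j∣q)

    p^k∣*⇔≤ν+ν : ∀ {k a c} → p ^ k ∣ a * c ⇔ k ≤ ν k a + ν k c
    p^k∣*⇔≤ν+ν {k} {a} {c} = mk⇔ to from
      where
      to : p ^ k ∣ a * c → k ≤ ν k a + ν k c
      to p^k∣ac with i , j , refl , p^i∣a , p^j∣c ← p^k∣*-split k a c p^k∣ac =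
        +-mono-≤ (∣⇒≤ν (m≤m+n i j) p^i∣a) (∣⇒≤ν (m≤n+m j i) p^j∣c)
      from : k ≤ ν k a + ν k c → p ^ k ∣ a * c
      from k≤ = ∣-trans (p^i∣p^j k≤)
        (subst (_∣ a * c) (sym (^-distribˡ-+-* p (ν k a) (ν k c))) (*-pres-∣ (p^ν∣ k a) (p^ν∣ k c)))

    p^k∣*⇒p∣ : ∀ {k} a {c} .{{_ : NonZero c}} → 0 < k → c < p ^ k → p ^ k ∣ a * c → p ∣ a
    p^k∣*⇒p∣ {k} a {c} 0<k c<p^k p^k∣ac = Equivalence.from (p∣⇔0<ν 0<k) (n≢0⇒n>0 λ νa≡0 →
      <⇒≱ (ν<cap c<p^k) (subst (λ x → k ≤ x + ν k c) νa≡0 (Equivalence.to p^k∣*⇔≤ν+ν p^k∣ac)))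

toℕ-0mod : ∀ m .{{_ : NonZero m}} → toℕ (0 mod m) ≡ 0
toℕ-0mod m = trans (toℕ-fromℕ< _) (m<n⇒m%n≡m {n = m} (>-nonZero⁻¹ m))

mod≡0mod⇔∣ : ∀ m .{{_ : NonZero m}} n → n mod m ≡ 0 mod m ⇔ m ∣ n
mod≡0mod⇔∣ m n = mk⇔
  (λ eq → m%n≡0⇒n∣m n m (begin
    n % m            ≡⟨ toℕ-fromℕ< _ ⟨
    toℕ (n mod m)    ≡⟨ cong toℕ eq ⟩
    toℕ (0 mod m)    ≡⟨ toℕ-0mod m ⟩
    0                ∎))
  (λ m∣n → toℕ-injective (trans (toℕ-fromℕ< _) (trans (n∣m⇒m%n≡0 n m m∣n) (sym (toℕ-0mod m)))))
  where open ≡-Reasoning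

module ZeroDivisorGraph (p β : ℕ) (prime : Prime p) where
  open Valuation p

  α : ℕ
  α = suc β

  open EquationalReasoning {k = equivalence}

  private
    instance
      nonZero-p : NonZero p
      nonZero-p = prime⇒nonZero prime

      nonZero-p^α : NonZero (p ^ α)
      nonZero-p^α = m^n≢0 p α

    Rα : Set
    Rα = R p α nonZero-p

  Annihilates : ℕ → ℕ → ℕ → ℕ → Set
  Annihilates a b c d = p ^ α ∣ a * c × p ∣ a * d + b * c

  *R≡0R⇔annihilates : ∀ (x y : Rα) → _*R_ p α nonZero-p x y ≡ 0R p α nonZero-p ⇔
                      Annihilates (toℕ (proj₁ x)) (toℕ (proj₂ x)) (toℕ (proj₁ y)) (toℕ (proj₂ y))
  *R≡0R⇔annihilates (a , b) (c , d) =
    (mod≡0mod⇔∣ (p ^ α) _ ×-⇔ mod≡0mod⇔∣ p _) ⇔-∘ mk⇔ ×-≡,≡←≡ ×-≡,≡→≡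

  annihilates-comm : ∀ a b c d → Annihilates a b c d ⇔ Annihilates c d a b
  annihilates-comm a b c d = mk⇔ (swap a b c d) (swap c d a b)
    where
    swap : ∀ a b c d → Annihilates a b c d → Annihilates c d a b
    swap a b c d (p^α∣ac , p∣ad+bc) =
      subst (p ^ α ∣_) (*-comm a c) p^α∣ac ,
      subst (p ∣_) (trans (+-comm (a * d) (b * c)) (cong₂ _+_ (*-comm b c) (*-comm a d))) p∣ad+bc

  weight : ℕ → ℕ → ℕ
  weight zero    zero    = 2 * α
  weight zero    (suc _) = suc (2 * β)
  weight (suc a) _       = 2 * ν α (suc a)

  p∣⇔0<weight : ∀ {a b} → p ∣ a ⇔ 0 < weight a b
  p∣⇔0<weight {zero}  {zero}  = mk⇔ (λ _ → z<s) (λ _ → p ∣0)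
  p∣⇔0<weight {zero}  {suc _} = mk⇔ (λ _ → z<s) (λ _ → p ∣0)
  p∣⇔0<weight {suc a}         =
    mk⇔ (*-monoʳ-< 2) (*-cancelˡ-< 2 0 (ν α (suc a))) ⇔-∘ p∣⇔0<ν z<s

  heavy⇔0< : ∀ {n} → 2 * α ≤ suc (2 * β) + n ⇔ 0 < n
  heavy⇔0< {n} = mk⇔
    (λ 2α≤ → +-cancelˡ-< (suc (2 * β)) 0 n (subst (_≤ suc (2 * β) + n) 2α≡ 2α≤))
    (λ 0<n → subst (_≤ suc (2 * β) + n) (sym (*-suc 2 β)) (m<m+n (suc (2 * β)) 0<n))
    where
    2α≡ : 2 * α ≡ suc (suc (2 * β) + 0)
    2α≡ = trans (*-suc 2 β) (cong suc (sym (+-identityʳ _)))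

  annihilates⇔heavy-zeroˡ : ∀ {b c d} → b < p →
                            Annihilates 0 b c d ⇔ 2 * α ≤ weight 0 b + weight c d
  annihilates⇔heavy-zeroˡ {zero}          _   = mk⇔ (λ _ → m≤m+n (2 * α) _) (λ _ → (p ^ α) ∣0 , p ∣0)
  annihilates⇔heavy-zeroˡ {suc b} {c} {d} b<p = begin
    Annihilates 0 (suc b) c d                     ∼⟨ mk⇔ (p∣bc⇒p∣c ∘ proj₂) (λ p∣c → (p ^ α) ∣0 , ∣n⇒∣m*n (suc b) p∣c) ⟩
    p ∣ c                                         ∼⟨ p∣⇔0<weight ⟩
    0 < weight c d                                ∼⟨ ⇔-sym heavy⇔0< ⟩
    2 * α ≤ weight 0 (suc b) + weight c d         ∎
    where
    p∣bc⇒p∣c : p ∣ suc b * c → p ∣ c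
    p∣bc⇒p∣c p∣bc with euclidsLemma (suc b) c prime p∣bc
    ... | inj₁ p∣b = contradiction (∣⇒≤ p∣b) (<⇒≱ b<p)
    ... | inj₂ p∣c = p∣c

  annihilates⇔heavy-suc : ∀ {a b c d} → suc a < p ^ α → suc c < p ^ α →
                Annihilates (suc a) b (suc c) d ⇔ 2 * α ≤ weight (suc a) b + weight (suc c) d
  annihilates⇔heavy-suc {a} {b} {c} {d} a<p^α c<p^α = begin
    Annihilates (suc a) b (suc c) d                       ∼⟨ mk⇔ proj₁ (λ p^α∣ac → p^α∣ac , p∣ad+bc p^α∣ac) ⟩
    p ^ α ∣ suc a * suc c                                 ∼⟨ p^k∣*⇔≤ν+ν prime ⟩
    α ≤ ν α (suc a) + ν α (suc c)                         ∼⟨ ≤⇔2*≤2*+2* {α} {ν α (suc a)} {ν α (suc c)} ⟩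
    2 * α ≤ weight (suc a) b + weight (suc c) d           ∎
    where
    p∣ad+bc : p ^ α ∣ suc a * suc c → p ∣ suc a * d + b * suc c
    p∣ad+bc p^α∣ac = ∣m∣n⇒∣m+n
      (∣m⇒∣m*n d (p^k∣*⇒p∣ prime {α} (suc a) z<s c<p^α p^α∣ac))
      (∣n⇒∣m*n b (p^k∣*⇒p∣ prime {α} (suc c) z<s a<p^α (subst (p ^ α ∣_) (*-comm (suc a) (suc c)) p^α∣ac)))

  annihilates⇔heavy : ∀ {a b c d} → a < p ^ α → b < p → c < p ^ α → d < p →
                      Annihilates a b c d ⇔ 2 * α ≤ weight a b + weight c d
  annihilates⇔heavy {zero} _ b<p _ _ = annihilates⇔heavy-zeroˡ b<p
  annihilates⇔heavy {suc a} {b} {zero} {d} _ _ _ d<p = begin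
    Annihilates (suc a) b 0 d                    ∼⟨ annihilates-comm (suc a) b 0 d ⟩
    Annihilates 0 d (suc a) b                    ∼⟨ annihilates⇔heavy-zeroˡ {d} {suc a} {b} d<p ⟩
    2 * α ≤ weight 0 d + weight (suc a) b        ≡⟨ cong (2 * α ≤_) (+-comm (weight 0 d) (weight (suc a) b)) ⟩
    2 * α ≤ weight (suc a) b + weight 0 d        ∎
  annihilates⇔heavy {suc a} {b} {suc c} {d} a<p^α _ c<p^α _ =
    annihilates⇔heavy-suc {a} {b} {c} {d} a<p^α c<p^α

  vertexWeight : Rα → ℕ
  vertexWeight (a , b) = weight (toℕ a) (toℕ b)

  *R≡0R⇔heavy : ∀ (x y : Rα) →
    _*R_ p α nonZero-p x y ≡ 0R p α nonZero-p ⇔ 2 * α ≤ vertexWeight x + vertexWeight y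
  *R≡0R⇔heavy x@(a , b) y@(c , d) =
    annihilates⇔heavy (toℕ<n a) (toℕ<n b) (toℕ<n c) (toℕ<n d) ⇔-∘ *R≡0R⇔annihilates x y

  isThresholdWeighting : IsThresholdWeighting (Adj (Γ p α nonZero-p)) vertexWeight (2 * α)
  isThresholdWeighting = record
    { irreflexive    = λ { x (x≢x , _) → x≢x refl }
    ; heavy⇒adjacent = λ {x} {y} x≢y heavy → x≢y , Equivalence.from (*R≡0R⇔heavy x y) heavy
    ; adjacent⇒heavy = λ {x} {y} (_ , xy≡0) → Equivalence.to (*R≡0R⇔heavy x y) xy≡0
    }

  0R-dominating : Dominating (Adj (Γ p α nonZero-p)) (0R p α nonZero-p)
  0R-dominating = heavy⇒dominating isThresholdWeighting
    (≤-reflexive (sym (cong₂ weight (toℕ-0mod (p ^ α)) (toℕ-0mod p))))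

mainTheorem4 : (p α : ℕ) → (pp : Prime p) → 0 < α →
    IsConnected (Γ p α (prime⇒nonZero pp)) × IsThreshold (Γ p α (prime⇒nonZero pp))
mainTheorem4 p zero    pp ()
mainTheorem4 p (suc β) pp _ =
    dominating⇒connected (Γ p α nz) (≡-dec _≟_ _≟_) 0R-dominating
  , thresholdWeighting⇒IsThreshold (Γ p α nz) isThresholdWeighting (↔⇒⤖ *↔×) (0R p α nz)
  where
  open ZeroDivisorGraph p β pp
  nz : NonZero p
  nz = prime⇒nonZero pp
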